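{- Let $p$ be prime and $n\ge2$. For every profinite group $G$, $$\bigcap_{s=1}^{n}T^{\bar{\mathbb U}_{n,s}}(G)=\bigcap_{s=1}^{n-1}T^{\mathbb U_s(\mathbb Z/p^{n-s})}(G).$$
   Context: For a commutative ring $R$, $\mathbb U_s(R)$ is the group of unipotent upper-triangular $(s+1)\times(s+1)$ matrices over $R$. For $1\le s\le n$, $\mathbb U_{n,s}=\mathbb U_s(\mathbb Z/p^{n-s+1})$ and $\bar{\mathbb U}_{n,s}$ is its quotient by the central subgroup $\{I+p^{n-s}cE_{1,s+1}\}$ of order $p$ (so e.g. $\bar{\mathbb U}_{n,1}\cong\mathbb Z/p^{n-1}$). For profinite groups $\mathbb U,G$, $T^{\mathbb U}(G)$ is the intersection of the kernels of all continuous homomorphisms $G\to\mathbb U$. -}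

module Defs where

open import Data.Nat as ℕ using (ℕ; zero; suc; _^_; _∸_)
open import Data.Integer as ℤ using (ℤ; +_; _-_; _*_; _+_)
open import Data.Integer.Divisibility using (_∣_)
open import Data.Fin as Fin using (Fin; toℕ; fromℕ)
open import Data.Fin.Properties using () renaming (_≟_ to _≟ᶠ_)
open import Data.Product using (Σ; ∃; _×_; _,_)
open import Data.Sum using (_⊎_)
open import Data.Unit using (⊤)
open import Data.Empty using (⊥)
open import Data.List using (List)
open import Data.List.Relation.Unary.Any using (Any)
open import Relation.Nullary using (yes; no; ¬_)
open import Relation.Binary.PropositionalEquality using (_≡_; _≢_)
open import Function.Bundles using (_⇔_)

Pred : Set → Set₁
Pred A = A → Set

record ProfiniteGroup : Set₁ where
  infixl 7 _∙_
  field
    Carrier : Set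
    _∙_     : Carrier → Carrier → Carrier
    ε       : Carrier
    _⁻¹     : Carrier → Carrier
    assoc     : ∀ x y z → (x ∙ y) ∙ z ≡ x ∙ (y ∙ z)
    identityˡ : ∀ x → ε ∙ x ≡ x
    identityʳ : ∀ x → x ∙ ε ≡ x
    inverseˡ  : ∀ x → (x ⁻¹) ∙ x ≡ ε
    inverseʳ  : ∀ x → x ∙ (x ⁻¹) ≡ ε
    Open      : Pred Carrier → Set
    open-ext  : ∀ U V → Open U → (∀ x → U x ⇔ V x) → Open V
    open-univ : Open (λ _ → ⊤)
    open-∅    : Open (λ _ → ⊥)
    open-⋃    : ∀ {I : Set} (U : I → Pred Carrier) →
                (∀ i → Open (U i)) → Open (λ x → ∃ λ i → U i x)
    open-∩    : ∀ U V → Open U → Open V → Open (λ x → U x × V x)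
    -- continuity of multiplication (product topology on G × G)
    mult-cont : ∀ W → Open W → ∀ x y → W (x ∙ y) →
                Σ (Pred Carrier) λ U → Σ (Pred Carrier) λ V →
                  Open U × Open V × U x × V y ×
                  (∀ a b → U a → V b → W (a ∙ b))
    inv-cont  : ∀ W → Open W → Open (λ x → W (x ⁻¹))
    hausdorff : ∀ x y → x ≢ y →
                Σ (Pred Carrier) λ U → Σ (Pred Carrier) λ V →
                  Open U × Open V × U x × V y × (∀ z → U z → V z → ⊥)
    compact   : ∀ {I : Set} (U : I → Pred Carrier) → (∀ i → Open (U i)) →
                (∀ x → ∃ λ i → U i x) →
                ∃ λ (is : List I) → ∀ x → Any (λ i → U i x) is
    -- totally disconnected: every subset containing two distinct
    -- points is disconnected (so connected components are singletons)
    tot-disc  : ∀ (S : Pred Carrier) x y → S x → S y → x ≢ y →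
                Σ (Pred Carrier) λ U → Σ (Pred Carrier) λ V →
                  Open U × Open V ×
                  (∀ z → S z → U z ⊎ V z) ×
                  (∀ z → S z → U z → V z → ⊥) ×
                  (∃ λ z → S z × U z) × (∃ λ z → S z × V z)

-- Integers modulo q, square matrices of size (s+1) over ℤ/q.

_≡_[mod_] : ℤ → ℤ → ℕ → Set
a ≡ b [mod q ] = (+ q) ∣ (a - b)

Σᶠ : ∀ m → (Fin m → ℤ) → ℤ
Σᶠ zero    f = + 0
Σᶠ (suc m) f = f Fin.zero + Σᶠ m (λ k → f (Fin.suc k))

Mat : ℕ → Set
Mat s = Fin (suc s) → Fin (suc s) → ℤ

_⊗_ : ∀ {s} → Mat s → Mat s → Mat s
_⊗_ {s} A B i j = Σᶠ (suc s) (λ k → A i k * B k j)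

δ : ∀ {m} → Fin m → Fin m → ℤ
δ i j with i ≟ᶠ j
... | yes _ = + 1
... | no  _ = + 0

𝟙 : ∀ {s} → Mat s
𝟙 i j = δ i j

Ecorner : ∀ {s} → Mat s
Ecorner {s} i j = δ i Fin.zero * δ j (fromℕ s)

I+cE : ∀ {s} → ℤ → Mat s
I+cE c i j = 𝟙 i j + c * Ecorner i j

MatEq : ∀ {s} → ℕ → Mat s → Mat s → Set
MatEq q A B = ∀ i j → A i j ≡ B i j [mod q ]

IsUnitri : ∀ {s} → ℕ → Mat s → Set
IsUnitri q A = (∀ i j → j Fin.< i → A i j ≡ + 0 [mod q ]) ×
               (∀ i → A i i ≡ + 1 [mod q ])

-- equality in the quotient 𝕌_s(ℤ/q) / {I + p^k c E_{1,s+1}}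
BarEq : ∀ {s} → ℕ → ℕ → Mat s → Mat s → Set
BarEq q r A B = ∃ λ (c : ℤ) → MatEq q A (B ⊗ I+cE ((+ r) * c))

-- Continuous homomorphisms from a profinite group into a finite
-- (discrete) group of matrices presented by a membership predicate
-- and an equality relation, and the subgroup T^𝕌(G).

module _ (G : ProfiniteGroup) where
  open ProfiniteGroup G

  IsContHom : ∀ {s} (inU : Mat s → Set) (_≈_ : Mat s → Mat s → Set) →
              (Carrier → Mat s) → Set₁
  IsContHom {s} inU _≈_ f =
    (∀ g → inU (f g)) ×
    (∀ x y → f (x ∙ y) ≈ (f x ⊗ f y)) ×
    -- continuity w.r.t. the discrete topology on the target group:
    -- the preimage of every subset of the group is open
    (∀ (S : Mat s → Set) →
       (∀ a b → inU a → inU b → a ≈ b → S a → S b) →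
       Open (λ g → S (f g)))

  T : ∀ {s} (inU : Mat s → Set) (_≈_ : Mat s → Mat s → Set) →
      Carrier → Set₁
  T inU _≈_ g = ∀ (f : Carrier → Mat _) → IsContHom inU _≈_ f → f g ≈ 𝟙

  T-U : ℕ → (s m : ℕ) → Carrier → Set₁
  T-U p s m = T {s} (IsUnitri (p ^ m)) (MatEq (p ^ m))

  T-Ubar : ℕ → (n s : ℕ) → Carrier → Set₁
  T-Ubar p n s = T {s} (IsUnitri (p ^ (n ∸ s ℕ.+ 1)))
                       (BarEq (p ^ (n ∸ s ℕ.+ 1)) (p ^ (n ∸ s)))

-- A continuous homomorphism f from G to Ū_{n,s} (s ≥ 1) is controlled by three homomorphisms,
-- which exist because right multiplication by I + c E_{1,s+1} only adds c times the first column
-- to the last one: its reduction modulo p^{n-s}, with values in 𝕌_s(ℤ/p^{n-s}), and its upper-left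
-- and lower-right blocks, with values in 𝕌_{s-1}(ℤ/p^{n-s+1}). If all three kill g, so does f:
-- every entry of f g other than the corner lies in a block or below the diagonal, and the
-- reduction makes the corner a multiple of p^{n-s}. Conversely A ↦ diag(1, A) maps 𝕌_s(ℤ/p^{n-s})
-- into Ū_{n,s+1}, and A is recovered as the lower-right block. The indices s = 0 and s = n needed
-- outside the range 1 ≤ s ≤ n - 1 come for free, as 𝕌_0 and 𝕌_s(ℤ/1) are trivial.

module Submission where

open import Defs
open import Data.Nat as ℕ using (ℕ; zero; suc; z≤n; s≤s; _≤_; _∸_; _^_)
import Data.Nat.Properties as ℕₚ
import Data.Nat.Divisibility as ℕ∣
open import Data.Nat.Primality using (Prime)
open import Data.Integer using (ℤ; +_; _-_; _*_; _+_; -_)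
import Data.Integer.Properties as ℤₚ
import Data.Integer.Divisibility.Signed as Signed
open import Data.Integer.Tactic.RingSolver using (solve-∀)
open import Data.Fin as Fin using (Fin; toℕ; fromℕ; inject₁)
import Data.Fin.Properties as Finₚ
open import Data.Fin.Relation.Unary.Top using (view; ‵fromℕ; ‵inject₁)
open import Data.Product using (∃; _,_; proj₁; proj₂)
open import Data.Sum using (inj₁; inj₂)
open import Function using (_∘_)
open import Function.Bundles using (_⇔_; mk⇔)
open import Relation.Nullary using (Dec; yes; no; contradiction)
open import Relation.Binary.PropositionalEquality

infix 4 _≈_[mod_]

-- Unlike _≡_[mod_], whose two sides occur only under _-_, this record lets Agda infer them.
record _≈_[mod_] (a b : ℤ) (q : ℕ) : Set where
  constructor mk≈
  field ≈⇒≡[mod] : a ≡ b [mod q ]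
open _≈_[mod_]

module _ {q : ℕ} where

  private
    fromSigned : ∀ {a b} → + q Signed.∣ a - b → a ≈ b [mod q ]
    fromSigned = mk≈ ∘ Signed.∣⇒∣ᵤ

    toSigned : ∀ {a b} → a ≈ b [mod q ] → + q Signed.∣ a - b
    toSigned = Signed.∣ᵤ⇒∣ ∘ ≈⇒≡[mod]

    divides-subst : ∀ {a b} → a ≡ b → + q Signed.∣ a → + q Signed.∣ b
    divides-subst = subst (+ q Signed.∣_)

  ≈-reflexive : ∀ {a b} → a ≡ b → a ≈ b [mod q ]
  ≈-reflexive {a} refl = fromSigned (Signed.divides (+ 0) (ℤₚ.+-inverseʳ a))

  ≈-refl : ∀ {a} → a ≈ a [mod q ]
  ≈-refl = ≈-reflexive refl

  ≈-sym : ∀ {a b} → a ≈ b [mod q ] → b ≈ a [mod q ]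
  ≈-sym {a} {b} a≈b =
    fromSigned (divides-subst (negate-diff a b) (Signed.∣m⇒∣-m (toSigned a≈b)))
    where
    negate-diff : ∀ a b → - (a - b) ≡ b - a
    negate-diff = solve-∀

  ≈-trans : ∀ {a b c} → a ≈ b [mod q ] → b ≈ c [mod q ] → a ≈ c [mod q ]
  ≈-trans {a} {b} {c} a≈b b≈c =
    fromSigned (divides-subst (telescope a b c) (Signed.∣m∣n⇒∣m+n (toSigned a≈b) (toSigned b≈c)))
    where
    telescope : ∀ a b c → (a - b) + (b - c) ≡ a - c
    telescope = solve-∀

  +-cong-≈ : ∀ {a b c d} → a ≈ b [mod q ] → c ≈ d [mod q ] → a + c ≈ b + d [mod q ]
  +-cong-≈ {a} {b} {c} {d} a≈b c≈d =
    fromSigned (divides-subst (regroup a b c d) (Signed.∣m∣n⇒∣m+n (toSigned a≈b) (toSigned c≈d)))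
    where
    regroup : ∀ a b c d → (a - b) + (c - d) ≡ (a + c) - (b + d)
    regroup = solve-∀

  *-congˡ-≈ : ∀ k {a b} → a ≈ b [mod q ] → k * a ≈ k * b [mod q ]
  *-congˡ-≈ k {a} {b} a≈b =
    fromSigned (divides-subst (distrib k a b) (Signed.∣n⇒∣m*n k (toSigned a≈b)))
    where
    distrib : ∀ k a b → k * (a - b) ≡ k * a - k * b
    distrib = solve-∀

  *-congʳ-≈ : ∀ k {a b} → a ≈ b [mod q ] → a * k ≈ b * k [mod q ]
  *-congʳ-≈ k {a} {b} a≈b =
    fromSigned (divides-subst (distrib k a b) (Signed.∣m⇒∣m*n k (toSigned a≈b)))
    where
    distrib : ∀ k a b → (a - b) * k ≡ a * k - b * k
    distrib = solve-∀

  +-multiple-≈ : ∀ x c y → x + (+ q * c) * y ≈ x [mod q ]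
  +-multiple-≈ x c y = fromSigned (Signed.divides (c * y) (cancel x c y (+ q)))
    where
    cancel : ∀ x c y q → x + (q * c) * y - x ≡ (c * y) * q
    cancel = solve-∀

  ≈0⇒multiple : ∀ {a} → a ≈ + 0 [mod q ] → ∃ λ c → a ≡ + q * c
  ≈0⇒multiple {a} a≈0 with toSigned a≈0
  ... | Signed.divides c a-0≡c*q =
    c , trans (sym (ℤₚ.+-identityʳ a)) (trans a-0≡c*q (ℤₚ.*-comm c (+ q)))

  ≈0-*ʳ : ∀ {a} b → a ≈ + 0 [mod q ] → a * b ≈ + 0 [mod q ]
  ≈0-*ʳ b a≈0 = ≈-trans (*-congʳ-≈ b a≈0) (≈-reflexive (ℤₚ.*-zeroˡ b))

  ≈0-*ˡ : ∀ a {b} → b ≈ + 0 [mod q ] → a * b ≈ + 0 [mod q ]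
  ≈0-*ˡ a b≈0 = ≈-trans (*-congˡ-≈ a b≈0) (≈-reflexive (ℤₚ.*-zeroʳ a))

  +-≈0ʳ : ∀ {a b c} → a ≈ b [mod q ] → c ≈ + 0 [mod q ] → a + c ≈ b [mod q ]
  +-≈0ʳ {b = b} a≈b c≈0 = ≈-trans (+-cong-≈ a≈b c≈0) (≈-reflexive (ℤₚ.+-identityʳ b))

  +-≈0ˡ : ∀ {a b c} → a ≈ + 0 [mod q ] → c ≈ b [mod q ] → a + c ≈ b [mod q ]
  +-≈0ˡ {b = b} a≈0 c≈b = ≈-trans (+-cong-≈ a≈0 c≈b) (≈-reflexive (ℤₚ.+-identityˡ b))

≈-weaken : ∀ {q r a b} → r ℕ∣.∣ q → a ≈ b [mod q ] → a ≈ b [mod r ]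
≈-weaken r∣q (mk≈ q∣a-b) = mk≈ (ℕ∣.∣-trans r∣q q∣a-b)

infix 4 _≈ᴹ_[mod_]

_≈ᴹ_[mod_] : ∀ {s} → Mat s → Mat s → ℕ → Set
A ≈ᴹ B [mod q ] = ∀ i j → A i j ≈ B i j [mod q ]

module _ {q s : ℕ} where

  MatEq⇒≈ᴹ : ∀ {A B : Mat s} → MatEq q A B → A ≈ᴹ B [mod q ]
  MatEq⇒≈ᴹ A≈B i j = mk≈ (A≈B i j)

  ≈ᴹ⇒MatEq : ∀ {A B : Mat s} → A ≈ᴹ B [mod q ] → MatEq q A B
  ≈ᴹ⇒MatEq A≈B i j = ≈⇒≡[mod] (A≈B i j)

  ≈ᴹ-trans : ∀ {A B C : Mat s} → A ≈ᴹ B [mod q ] → B ≈ᴹ C [mod q ] → A ≈ᴹ C [mod q ]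
  ≈ᴹ-trans A≈B B≈C i j = ≈-trans (A≈B i j) (B≈C i j)

  IsUnitri-below : (A : Mat s) → IsUnitri q A → ∀ {i j} → j Fin.< i → A i j ≈ + 0 [mod q ]
  IsUnitri-below A (below , _) j<i = mk≈ (below _ _ j<i)

  IsUnitri-diag : (A : Mat s) → IsUnitri q A → ∀ i → A i i ≈ + 1 [mod q ]
  IsUnitri-diag A (_ , diag) i = mk≈ (diag i)

IsUnitri-weaken : ∀ {q r s} (A : Mat s) → r ℕ∣.∣ q → IsUnitri q A → IsUnitri r A
IsUnitri-weaken A r∣q A-unitri =
  (λ i j j<i → ≈⇒≡[mod] (≈-weaken r∣q (IsUnitri-below A A-unitri j<i))) ,
  (λ i → ≈⇒≡[mod] (≈-weaken r∣q (IsUnitri-diag A A-unitri i)))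

Σᶠ-cong : ∀ m {f g : Fin m → ℤ} → (∀ k → f k ≡ g k) → Σᶠ m f ≡ Σᶠ m g
Σᶠ-cong zero    f≡g = refl
Σᶠ-cong (suc m) f≡g = cong₂ _+_ (f≡g Fin.zero) (Σᶠ-cong m (f≡g ∘ Fin.suc))

Σᶠ-zero : ∀ m (f : Fin m → ℤ) → (∀ k → f k ≡ + 0) → Σᶠ m f ≡ + 0
Σᶠ-zero zero    f f≡0 = refl
Σᶠ-zero (suc m) f f≡0 = cong₂ _+_ (f≡0 Fin.zero) (Σᶠ-zero m (f ∘ Fin.suc) (f≡0 ∘ Fin.suc))

Σᶠ-+ : ∀ m (f g : Fin m → ℤ) → Σᶠ m (λ k → f k + g k) ≡ Σᶠ m f + Σᶠ m g
Σᶠ-+ zero    f g = refl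
Σᶠ-+ (suc m) f g = begin
  (f₀ + g₀) + Σᶠ m (λ k → f (Fin.suc k) + g (Fin.suc k))
    ≡⟨ cong (λ z → (f₀ + g₀) + z) (Σᶠ-+ m (f ∘ Fin.suc) (g ∘ Fin.suc)) ⟩
  (f₀ + g₀) + (Σᶠ m (f ∘ Fin.suc) + Σᶠ m (g ∘ Fin.suc))
    ≡⟨ interchange f₀ g₀ _ _ ⟩
  (f₀ + Σᶠ m (f ∘ Fin.suc)) + (g₀ + Σᶠ m (g ∘ Fin.suc)) ∎
  where
  open ≡-Reasoning
  f₀ = f Fin.zero
  g₀ = g Fin.zero
  interchange : ∀ a b c d → (a + b) + (c + d) ≡ (a + c) + (b + d)
  interchange = solve-∀

Σᶠ-*ʳ : ∀ m (f : Fin m → ℤ) c → Σᶠ m (λ k → f k * c) ≡ Σᶠ m f * c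
Σᶠ-*ʳ zero    f c = refl
Σᶠ-*ʳ (suc m) f c =
  trans (cong (λ z → f Fin.zero * c + z) (Σᶠ-*ʳ m (f ∘ Fin.suc) c))
        (sym (ℤₚ.*-distribʳ-+ c (f Fin.zero) (Σᶠ m (f ∘ Fin.suc))))

Σᶠ-last : ∀ m (f : Fin (suc m) → ℤ) → Σᶠ (suc m) f ≡ Σᶠ m (f ∘ inject₁) + f (fromℕ m)
Σᶠ-last zero    f = trans (ℤₚ.+-identityʳ (f Fin.zero)) (sym (ℤₚ.+-identityˡ (f Fin.zero)))
Σᶠ-last (suc m) f =
  trans (cong (λ z → f Fin.zero + z) (Σᶠ-last m (f ∘ Fin.suc)))
        (sym (ℤₚ.+-assoc (f Fin.zero) (Σᶠ m (f ∘ Fin.suc ∘ inject₁)) (f (fromℕ (suc m)))))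

δ-refl : ∀ {m} (i : Fin m) → δ i i ≡ + 1
δ-refl i with i Finₚ.≟ i
... | yes _   = refl
... | no  i≢i = contradiction refl i≢i

δ-≢ : ∀ {m} {i j : Fin m} → i ≢ j → δ i j ≡ + 0
δ-≢ {i = i} {j} i≢j with i Finₚ.≟ j
... | yes i≡j = contradiction i≡j i≢j
... | no  _   = refl

δ-suc : ∀ {m} (i j : Fin m) → δ (Fin.suc i) (Fin.suc j) ≡ δ i j
δ-suc i j = by-cases (i Finₚ.≟ j)
  where
  by-cases : Dec (i ≡ j) → δ (Fin.suc i) (Fin.suc j) ≡ δ i j
  by-cases (yes refl) = trans (δ-refl (Fin.suc i)) (sym (δ-refl i))
  by-cases (no i≢j)   = trans (δ-≢ (i≢j ∘ Finₚ.suc-injective)) (sym (δ-≢ i≢j))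

δ-inject₁-fromℕ : ∀ {m} (i : Fin m) → δ (inject₁ i) (fromℕ m) ≡ + 0
δ-inject₁-fromℕ i = δ-≢ (Finₚ.fromℕ≢inject₁ ∘ sym)

Σᶠ-*δ : ∀ m (f : Fin m → ℤ) j → Σᶠ m (λ k → f k * δ k j) ≡ f j
Σᶠ-*δ (suc m) f Fin.zero =
  trans (cong₂ _+_ (ℤₚ.*-identityʳ (f Fin.zero))
                   (Σᶠ-zero m (λ k → f (Fin.suc k) * + 0) (ℤₚ.*-zeroʳ ∘ f ∘ Fin.suc)))
        (ℤₚ.+-identityʳ (f Fin.zero))
Σᶠ-*δ (suc m) f (Fin.suc j) = begin
  f Fin.zero * + 0 + Σᶠ m (λ k → f (Fin.suc k) * δ (Fin.suc k) (Fin.suc j))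
    ≡⟨ cong₂ _+_ (ℤₚ.*-zeroʳ (f Fin.zero))
                 (Σᶠ-cong m (λ k → cong (f (Fin.suc k) *_) (δ-suc k j))) ⟩
  + 0 + Σᶠ m (λ k → f (Fin.suc k) * δ k j)
    ≡⟨ ℤₚ.+-identityˡ _ ⟩
  Σᶠ m (λ k → f (Fin.suc k) * δ k j)
    ≡⟨ Σᶠ-*δ m (f ∘ Fin.suc) j ⟩
  f (Fin.suc j) ∎
  where open ≡-Reasoning

⊗-I+cE : ∀ {s} (M : Mat s) c i j →
         (M ⊗ I+cE c) i j ≡ M i j + c * (M i Fin.zero * δ j (fromℕ s))
⊗-I+cE {s} M c i j = begin
  Σᶠ (suc s) (λ k → M i k * (δ k j + c * (δ k Fin.zero * last)))
    ≡⟨ Σᶠ-cong (suc s) (λ k → expand (M i k) (δ k j) c (δ k Fin.zero) last) ⟩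
  Σᶠ (suc s) (λ k → M i k * δ k j + M i k * δ k Fin.zero * (c * last))
    ≡⟨ Σᶠ-+ (suc s) (λ k → M i k * δ k j) (λ k → M i k * δ k Fin.zero * (c * last)) ⟩
  Σᶠ (suc s) (λ k → M i k * δ k j) + Σᶠ (suc s) (λ k → M i k * δ k Fin.zero * (c * last))
    ≡⟨ cong₂ _+_ (Σᶠ-*δ (suc s) (M i) j) (Σᶠ-*ʳ (suc s) first-column (c * last)) ⟩
  M i j + Σᶠ (suc s) first-column * (c * last)
    ≡⟨ cong (λ z → M i j + z * (c * last)) (Σᶠ-*δ (suc s) (M i) Fin.zero) ⟩
  M i j + M i Fin.zero * (c * last)
    ≡⟨ cong (λ z → M i j + z) (swap (M i Fin.zero) c last) ⟩
  M i j + c * (M i Fin.zero * last) ∎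
  where
  open ≡-Reasoning
  last = δ j (fromℕ s)
  first-column = λ k → M i k * δ k Fin.zero
  expand : ∀ m a c b d → m * (a + c * (b * d)) ≡ m * a + m * b * (c * d)
  expand = solve-∀
  swap : ∀ m c d → m * (c * d) ≡ c * (m * d)
  swap = solve-∀

I+cE-corner : ∀ {s} d → I+cE {suc s} d Fin.zero (fromℕ (suc s)) ≡ d
I+cE-corner {s} d = begin
  + 0 + d * (+ 1 * δ (fromℕ (suc s)) (fromℕ (suc s)))
    ≡⟨ cong (λ z → + 0 + d * (+ 1 * z)) (δ-refl (fromℕ (suc s))) ⟩
  + 0 + d * + 1
    ≡⟨ trans (ℤₚ.+-identityˡ _) (ℤₚ.*-identityʳ d) ⟩
  d ∎
  where open ≡-Reasoning

I+cE-off-corner : ∀ {s} d (i j : Fin (suc s)) → Ecorner i j ≡ + 0 → I+cE d i j ≡ 𝟙 i j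
I+cE-off-corner d i j E≡0 =
  trans (cong (λ z → 𝟙 i j + d * z) E≡0)
        (trans (cong (λ z → 𝟙 i j + z) (ℤₚ.*-zeroʳ d)) (ℤₚ.+-identityʳ (𝟙 i j)))

BarEq⇒≈ : ∀ {q r s} (A B : Mat s) → BarEq q r A B → ∀ {i j} →
          B i Fin.zero * δ j (fromℕ s) ≈ + 0 [mod q ] → A i j ≈ B i j [mod q ]
BarEq⇒≈ {r = r} A B (c , A≈B·I+cE) {i} {j} off-corner =
  ≈-trans (mk≈ (A≈B·I+cE i j))
    (≈-trans (≈-reflexive (⊗-I+cE B (+ r * c) i j))
             (+-≈0ʳ ≈-refl (≈0-*ˡ (+ r * c) off-corner)))

BarEq⇒≈ᴹ : ∀ {q r s} (A B : Mat s) → r ℕ∣.∣ q → BarEq q r A B → A ≈ᴹ B [mod r ]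
BarEq⇒≈ᴹ {r = r} {s} A B r∣q (c , A≈B·I+cE) i j =
  ≈-trans (≈-weaken r∣q (mk≈ (A≈B·I+cE i j)))
    (≈-trans (≈-reflexive (⊗-I+cE B (+ r * c) i j))
             (+-multiple-≈ (B i j) c (B i Fin.zero * δ j (fromℕ s))))

≈ᴹ⇒BarEq : ∀ {q r s} {A B : Mat s} → A ≈ᴹ B [mod q ] → BarEq q r A B
≈ᴹ⇒BarEq {r = r} {s} {A} {B} A≈B = + 0 , λ i j →
  ≈⇒≡[mod] (≈-trans (A≈B i j)
                    (≈-reflexive (sym (trans (⊗-I+cE B (+ r * + 0) i j) (no-correction i j)))))
  where
  no-correction : ∀ i j → B i j + (+ r * + 0) * (B i Fin.zero * δ j (fromℕ s)) ≡ B i j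
  no-correction i j =
    trans (cong (λ z → B i j + z * (B i Fin.zero * δ j (fromℕ s))) (ℤₚ.*-zeroʳ (+ r)))
          (ℤₚ.+-identityʳ (B i j))

infixr 25 1⊕_

1⊕_ : ∀ {s} → Mat s → Mat (suc s)
(1⊕ A) Fin.zero    Fin.zero    = + 1
(1⊕ A) Fin.zero    (Fin.suc j) = + 0
(1⊕ A) (Fin.suc i) Fin.zero    = + 0
(1⊕ A) (Fin.suc i) (Fin.suc j) = A i j

lowerRight : ∀ {s} → Mat (suc s) → Mat s
lowerRight A i j = A (Fin.suc i) (Fin.suc j)

upperLeft : ∀ {s} → Mat (suc s) → Mat s
upperLeft A i j = A (inject₁ i) (inject₁ j)

module _ {q s : ℕ} where

  1⊕-IsUnitri : (A : Mat s) → IsUnitri q A → IsUnitri q (1⊕ A)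
  1⊕-IsUnitri A A-unitri = (λ i j j<i → ≈⇒≡[mod] (below i j j<i)) , (≈⇒≡[mod] ∘ diag)
    where
    below : ∀ i j → j Fin.< i → (1⊕ A) i j ≈ + 0 [mod q ]
    below (Fin.suc i) Fin.zero    _         = ≈-refl
    below (Fin.suc i) (Fin.suc j) (s≤s j<i) = IsUnitri-below A A-unitri j<i
    diag : ∀ i → (1⊕ A) i i ≈ + 1 [mod q ]
    diag Fin.zero    = ≈-refl
    diag (Fin.suc i) = IsUnitri-diag A A-unitri i

  1⊕-cong : ∀ {A B : Mat s} → A ≈ᴹ B [mod q ] → 1⊕ A ≈ᴹ 1⊕ B [mod q ]
  1⊕-cong A≈B Fin.zero    Fin.zero    = ≈-refl
  1⊕-cong A≈B Fin.zero    (Fin.suc j) = ≈-refl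
  1⊕-cong A≈B (Fin.suc i) Fin.zero    = ≈-refl
  1⊕-cong A≈B (Fin.suc i) (Fin.suc j) = A≈B i j

1⊕-⊗ : ∀ {s} (A B : Mat s) i j → (1⊕ A ⊗ 1⊕ B) i j ≡ (1⊕ (A ⊗ B)) i j
1⊕-⊗ {s} A B Fin.zero    Fin.zero    =
  cong (λ z → + 1 + z) (Σᶠ-zero (suc s) (λ k → + 0 * (1⊕ B) (Fin.suc k) Fin.zero) (λ _ → refl))
1⊕-⊗ {s} A B Fin.zero    (Fin.suc j) =
  cong (λ z → + 0 + z) (Σᶠ-zero (suc s) (λ k → + 0 * B k j) (λ _ → refl))
1⊕-⊗ {s} A B (Fin.suc i) Fin.zero    =
  cong (λ z → + 0 + z) (Σᶠ-zero (suc s) (λ k → A i k * + 0) (ℤₚ.*-zeroʳ ∘ A i))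
1⊕-⊗ {s} A B (Fin.suc i) (Fin.suc j) = ℤₚ.+-identityˡ _

module _ {q s : ℕ} where

  lowerRight-IsUnitri : (A : Mat (suc s)) → IsUnitri q A → IsUnitri q (lowerRight A)
  lowerRight-IsUnitri A (below , diag) =
    (λ i j j<i → below (Fin.suc i) (Fin.suc j) (s≤s j<i)) , (diag ∘ Fin.suc)

  upperLeft-IsUnitri : (A : Mat (suc s)) → IsUnitri q A → IsUnitri q (upperLeft A)
  upperLeft-IsUnitri A (below , diag) =
    (λ i j j<i → below (inject₁ i) (inject₁ j)
                   (subst₂ ℕ._<_ (sym (Finₚ.toℕ-inject₁ j)) (sym (Finₚ.toℕ-inject₁ i)) j<i)) ,
    (diag ∘ inject₁)

  lowerRight-⊗ : (A B : Mat (suc s)) → IsUnitri q A →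
                 lowerRight (A ⊗ B) ≈ᴹ lowerRight A ⊗ lowerRight B [mod q ]
  lowerRight-⊗ A B A-unitri i j =
    +-≈0ˡ (≈0-*ʳ (B Fin.zero (Fin.suc j)) (IsUnitri-below A A-unitri (s≤s z≤n))) ≈-refl

  upperLeft-⊗ : (A B : Mat (suc s)) → IsUnitri q B →
                upperLeft (A ⊗ B) ≈ᴹ upperLeft A ⊗ upperLeft B [mod q ]
  upperLeft-⊗ A B B-unitri i j =
    ≈-trans (≈-reflexive (Σᶠ-last (suc s) (λ k → A (inject₁ i) k * B k (inject₁ j))))
            (+-≈0ʳ ≈-refl (≈0-*ˡ (A (inject₁ i) (fromℕ (suc s)))
                                  (IsUnitri-below B B-unitri inject₁-j<last)))
    where
    inject₁-j<last : inject₁ j Fin.< fromℕ (suc s)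
    inject₁-j<last =
      subst (toℕ (inject₁ j) ℕ.<_) (sym (Finₚ.toℕ-fromℕ (suc s))) (Finₚ.inject₁ℕ< j)

  upperLeft-BarEq : ∀ {r} (A B : Mat (suc s)) → BarEq q r A B →
                    upperLeft A ≈ᴹ upperLeft B [mod q ]
  upperLeft-BarEq {r} A B A≈B i j =
    BarEq⇒≈ {r = r} A B A≈B
      (≈-reflexive (trans (cong (B (inject₁ i) Fin.zero *_) (δ-inject₁-fromℕ j))
                          (ℤₚ.*-zeroʳ (B (inject₁ i) Fin.zero))))

  lowerRight-BarEq : ∀ {r} (A B : Mat (suc s)) →
                     (∀ i → A (Fin.suc i) Fin.zero ≈ + 0 [mod q ]) →
                     BarEq q r A B → lowerRight A ≈ᴹ lowerRight B [mod q ]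
  lowerRight-BarEq {r} A B first-column≈0 A≈B i j =
    BarEq⇒≈ {r = r} A B A≈B (≈0-*ʳ _ B-first-column≈0)
    where
    B-first-column≈0 : B (Fin.suc i) Fin.zero ≈ + 0 [mod q ]
    B-first-column≈0 =
      ≈-trans (≈-sym (BarEq⇒≈ {r = r} A B A≈B (≈-reflexive (ℤₚ.*-zeroʳ (B (Fin.suc i) Fin.zero)))))
              (first-column≈0 i)

  lowerRight-𝟙 : lowerRight {s} 𝟙 ≈ᴹ 𝟙 [mod q ]
  lowerRight-𝟙 i j = ≈-reflexive (δ-suc i j)

BarEq-𝟙-from-blocks : ∀ {q r s} (A : Mat (suc s)) → IsUnitri q A →
                      A Fin.zero (fromℕ (suc s)) ≈ + 0 [mod r ] →
                      upperLeft A ≈ᴹ 𝟙 [mod q ] → lowerRight A ≈ᴹ 𝟙 [mod q ] →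
                      BarEq q r A 𝟙
BarEq-𝟙-from-blocks {q} {r} A A-unitri corner≈0 upperLeft≈𝟙 lowerRight≈𝟙 =
  c , λ i j → ≈⇒≡[mod] (≈-trans (entry i j) (≈-reflexive (sym (⊗-I+cE 𝟙 d i j))))
  where
  c = proj₁ (≈0⇒multiple corner≈0)
  d = + r * c

  δ-zero-inject₁ : ∀ {m} (j : Fin (suc m)) → δ Fin.zero j ≡ δ Fin.zero (inject₁ j)
  δ-zero-inject₁ Fin.zero    = refl
  δ-zero-inject₁ (Fin.suc j) = refl

  entry : ∀ i j → A i j ≈ I+cE d i j [mod q ]
  entry Fin.zero j with view j
  ... | ‵fromℕ      = ≈-reflexive (trans (proj₂ (≈0⇒multiple corner≈0)) (sym (I+cE-corner d)))
  ... | ‵inject₁ j′ =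
    ≈-trans (upperLeft≈𝟙 Fin.zero j′)
            (≈-reflexive (trans (δ-zero-inject₁ j′) (sym (I+cE-off-corner d Fin.zero (inject₁ j′) E≡0))))
    where
    E≡0 : Ecorner Fin.zero (inject₁ j′) ≡ + 0
    E≡0 = cong (λ z → + 1 * z) (δ-inject₁-fromℕ j′)
  entry (Fin.suc i) Fin.zero    =
    ≈-trans (IsUnitri-below A A-unitri (s≤s z≤n))
            (≈-reflexive (sym (I+cE-off-corner d (Fin.suc i) Fin.zero refl)))
  entry (Fin.suc i) (Fin.suc j) =
    ≈-trans (lowerRight≈𝟙 i j)
            (≈-reflexive (trans (sym (δ-suc i j)) (sym (I+cE-off-corner d (Fin.suc i) (Fin.suc j) refl))))

module _ (G : ProfiniteGroup) where
  open ProfiniteGroup G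

  IsContHom-map : ∀ {s t} {inU : Mat s → Set} {_∼_ : Mat s → Mat s → Set}
                  {inV : Mat t → Set} {_≈_ : Mat t → Mat t → Set}
                  (φ : Mat s → Mat t) →
                  (∀ {a} → inU a → inV (φ a)) →
                  (∀ {a b} → inU a → inU b → a ∼ b → φ a ≈ φ b) →
                  (∀ {a b c} → inU a → inU b → inU c → c ∼ (a ⊗ b) → φ c ≈ (φ a ⊗ φ b)) →
                  ∀ {f} → IsContHom G inU _∼_ f → IsContHom G inV _≈_ (φ ∘ f)
  IsContHom-map φ φ-in φ-resp φ-hom (f-in , f-hom , f-cont) =
    φ-in ∘ f-in ,
    (λ x y → φ-hom (f-in x) (f-in y) (f-in (x ∙ y)) (f-hom x y)) ,
    (λ S S-resp → f-cont (S ∘ φ)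
                    (λ a b a∈ b∈ a∼b → S-resp _ _ (φ-in a∈) (φ-in b∈) (φ-resp a∈ b∈ a∼b)))

  module _ {q s : ℕ} where

    reduce-IsContHom : ∀ {r f} → r ℕ∣.∣ q → IsContHom G {s} (IsUnitri q) (BarEq q r) f →
                       IsContHom G (IsUnitri r) (MatEq r) f
    reduce-IsContHom r∣q =
      IsContHom-map (λ A → A)
        (λ {A} → IsUnitri-weaken A r∣q)
        (λ {A} {B} _ _ A≈B → ≈ᴹ⇒MatEq (BarEq⇒≈ᴹ A B r∣q A≈B))
        (λ {A} {B} {C} _ _ _ C≈AB → ≈ᴹ⇒MatEq (BarEq⇒≈ᴹ C (A ⊗ B) r∣q C≈AB))

    1⊕-IsContHom : ∀ {r f} → IsContHom G {s} (IsUnitri q) (MatEq q) f →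
                   IsContHom G (IsUnitri q) (BarEq q r) (1⊕_ ∘ f)
    1⊕-IsContHom {r} =
      IsContHom-map 1⊕_
        (λ {A} → 1⊕-IsUnitri A)
        (λ _ _ A≈B → ≈ᴹ⇒BarEq {r = r} (1⊕-cong (MatEq⇒≈ᴹ A≈B)))
        (λ {A} {B} _ _ _ C≈AB →
           ≈ᴹ⇒BarEq {r = r} (≈ᴹ-trans (1⊕-cong (MatEq⇒≈ᴹ C≈AB))
                                      (λ i j → ≈-reflexive (sym (1⊕-⊗ A B i j)))))

    lowerRight-IsContHom : ∀ {r f} → IsContHom G {suc s} (IsUnitri q) (BarEq q r) f →
                           IsContHom G (IsUnitri q) (MatEq q) (lowerRight ∘ f)
    lowerRight-IsContHom {r} =
      IsContHom-map lowerRight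
        (λ {A} → lowerRight-IsUnitri A)
        (λ {A} {B} A∈ _ A≈B → ≈ᴹ⇒MatEq (lowerRight-BarEq {r = r} A B (first-column A A∈) A≈B))
        (λ {A} {B} {C} A∈ _ C∈ C≈AB →
           ≈ᴹ⇒MatEq (≈ᴹ-trans (lowerRight-BarEq {r = r} C (A ⊗ B) (first-column C C∈) C≈AB)
                              (lowerRight-⊗ A B A∈)))
      where
      first-column : ∀ A → IsUnitri q A → ∀ i → A (Fin.suc i) Fin.zero ≈ + 0 [mod q ]
      first-column A A∈ i = IsUnitri-below A A∈ (s≤s z≤n)

    upperLeft-IsContHom : ∀ {r f} → IsContHom G {suc s} (IsUnitri q) (BarEq q r) f →
                          IsContHom G (IsUnitri q) (MatEq q) (upperLeft ∘ f)
    upperLeft-IsContHom {r} =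
      IsContHom-map upperLeft
        (λ {A} → upperLeft-IsUnitri A)
        (λ {A} {B} _ _ A≈B → ≈ᴹ⇒MatEq (upperLeft-BarEq {r = r} A B A≈B))
        (λ {A} {B} {C} _ B∈ _ C≈AB →
           ≈ᴹ⇒MatEq (≈ᴹ-trans (upperLeft-BarEq {r = r} C (A ⊗ B) C≈AB) (upperLeft-⊗ A B B∈)))

  module _ {q : ℕ} {g : Carrier} where

    T-Ubar⇒T-U : ∀ {r s} → T G {suc s} (IsUnitri q) (BarEq q r) g →
                 T G {s} (IsUnitri q) (MatEq q) g
    T-Ubar⇒T-U {r} t f f-hom = ≈ᴹ⇒MatEq (≈ᴹ-trans f[g]≈𝟙 lowerRight-𝟙)
      where
      f[g]≈𝟙 : f g ≈ᴹ lowerRight 𝟙 [mod q ]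
      f[g]≈𝟙 = lowerRight-BarEq {r = r} (1⊕ f g) 𝟙 (λ _ → ≈-refl)
                                (t (1⊕_ ∘ f) (1⊕-IsContHom {r = r} f-hom))

    T-U-blocks⇒T-Ubar : ∀ {r s} → r ℕ∣.∣ q →
                        T G {suc s} (IsUnitri r) (MatEq r) g → T G {s} (IsUnitri q) (MatEq q) g →
                        T G {suc s} (IsUnitri q) (BarEq q r) g
    T-U-blocks⇒T-Ubar {r} r∣q t-whole t-block f f-hom =
      BarEq-𝟙-from-blocks (f g) (proj₁ f-hom g)
        (MatEq⇒≈ᴹ {A = f g} {𝟙} (t-whole f (reduce-IsContHom r∣q f-hom)) Fin.zero (fromℕ _))
        (MatEq⇒≈ᴹ (t-block (upperLeft ∘ f) (upperLeft-IsContHom {r = r} f-hom)))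
        (MatEq⇒≈ᴹ (t-block (lowerRight ∘ f) (lowerRight-IsContHom {r = r} f-hom)))

    T-U-size-0 : T G {0} (IsUnitri q) (MatEq q) g
    T-U-size-0 f f-hom Fin.zero Fin.zero = proj₂ (proj₁ f-hom g) Fin.zero

  T-U-mod-1 : ∀ {s g} → T G {s} (IsUnitri 1) (MatEq 1) g
  T-U-mod-1 f f-hom i j = ℕ∣.1∣ _

p^k∣p^[k+1] : ∀ p k → p ^ k ℕ∣.∣ p ^ (k ℕ.+ 1)
p^k∣p^[k+1] p k = subst (λ e → p ^ k ℕ∣.∣ p ^ e) (ℕₚ.+-comm 1 k) (ℕ∣.n∣m*n p)

∸-+1 : ∀ {m s} → s ≤ m → m ∸ s ℕ.+ 1 ≡ suc m ∸ s
∸-+1 s≤m = trans (ℕₚ.+-comm _ 1) (sym (ℕₚ.+-∸-assoc 1 s≤m))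

proposition10p1 : ∀ (p n : ℕ) → Prime p → 2 ≤ n →
    (G : ProfiniteGroup) → (g : ProfiniteGroup.Carrier G) →
    ((∀ s → 1 ≤ s → s ≤ n → T-Ubar G p n s g) ⇔
     (∀ s → 1 ≤ s → s ≤ n ∸ 1 → T-U G p s (n ∸ s) g))
proposition10p1 p zero    _ () G g
proposition10p1 p (suc m) _ _  G g = mk⇔ to from
  where
  to : (∀ s → 1 ≤ s → s ≤ suc m → T-Ubar G p (suc m) s g) →
       ∀ s → 1 ≤ s → s ≤ m → T-U G p s (suc m ∸ s) g
  to H s _ s≤m = subst (λ k → T-U G p s k g) (∸-+1 s≤m)
                       (T-Ubar⇒T-U G {r = p ^ (m ∸ s)} (H (suc s) (s≤s z≤n) (s≤s s≤m)))

  from : (∀ s → 1 ≤ s → s ≤ m → T-U G p s (suc m ∸ s) g) →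
         ∀ s → 1 ≤ s → s ≤ suc m → T-Ubar G p (suc m) s g
  from H (suc s) _ (s≤s s≤m) =
    T-U-blocks⇒T-Ubar G (p^k∣p^[k+1] p (m ∸ s)) (H′ (suc s) (s≤s s≤m))
      (subst (λ k → T-U G p s k g) (sym (∸-+1 s≤m)) (H′ s (ℕₚ.m≤n⇒m≤1+n s≤m)))
    where
    H′ : ∀ s → s ≤ suc m → T-U G p s (suc m ∸ s) g
    H′ zero    _         = T-U-size-0 G
    H′ (suc s) (s≤s s≤m) with ℕₚ.m≤n⇒m<n∨m≡n s≤m
    ... | inj₁ s<m  = H (suc s) (s≤s z≤n) s<m
    ... | inj₂ refl = subst (λ k → T-U G p (suc s) k g) (sym (ℕₚ.n∸n≡0 s)) (T-U-mod-1 G)
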